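{- For all integers $k\ge 2$ and $c\ge 1$ there exists a tight circular $\mathrm{SCCD}(2c(k-1)+1,\,k,\,c^2(2k-2)+c)$.
   Context: A circular single change covering design $\mathrm{SCCD}(v,k,b)$ is a $v$-set $X$ with a cyclically ordered list $(B_1,\dots,B_b)$ of $k$-subsets of $X$ with $|B_i\cap B_{i+1}|=k-1$ for all $i$ (indices mod $b$) such that every pair of elements of $X$ is contained in some block. It is tight if $\binom{v}{2}/(k-1)$ is an integer and $b=\binom{v}{2}/(k-1)$ (equivalently, each pair is covered exactly once, where a pair is covered in $B_i$ if it lies in $B_i$ and contains the element of $B_i\setminus B_{i-1}$). -}

module Defs where

open import Data.Nat using (ℕ; suc; zero; _*_; _∸_)
open import Data.Nat.Combinatorics using (_C_)
open import Data.Fin using (Fin; toℕ)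
open import Data.Fin.Subset using (Subset; ∣_∣; _∩_; _∈_)
open import Data.Product using (_×_; ∃-syntax)
open import Data.Sum using (_⊎_)
open import Relation.Binary.PropositionalEquality using (_≡_; _≢_)

CyclicSucc : ∀ {b} → Fin b → Fin b → Set
CyclicSucc {b} i j = (suc (toℕ i) ≡ toℕ j) ⊎ (suc (toℕ i) ≡ b × toℕ j ≡ zero)

record SCCD (v k b : ℕ) : Set where
  field
    block       : Fin b → Subset v
    block-size  : ∀ i → ∣ block i ∣ ≡ k
    single-change : ∀ i j → CyclicSucc i j → ∣ block i ∩ block j ∣ ≡ k ∸ 1
    covering    : ∀ (x y : Fin v) → x ≢ y → ∃[ i ] (x ∈ block i × y ∈ block i)

-- Tightness: (v choose 2)/(k-1) is an integer and b equals it,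
-- i.e. b * (k-1) ≡ v C 2 (with k ≥ 2 this forces divisibility and the value).
TightParams : ℕ → ℕ → ℕ → Set
TightParams v k b = b * (k ∸ 1) ≡ v C 2

record TightSCCD (v k b : ℕ) : Set where
  field
    design : SCCD v k b
    tight  : TightParams v k b

{-# OPTIONS --safe #-}
-- Work in ℤ_v with v = 2cm + 1 and m = k − 1. The c base blocks E_s = {1,…,m} ∪ {(s+1)m + 1}
-- all contain the core {1,…,m}, and their translates are listed round by round:
--   E_0, …, E_{c−1}, E_0 − 1, …, E_{c−1} − 1, E_0 − 2, …   (v·c blocks).
-- Inside a round consecutive blocks share exactly the core, and so do E_{c−1} and
-- E_0 − 1 = {0,…,m}; hence every step changes a single point. The extra point of E_s differs
-- from the core by sm + 1, …, (s+1)m, so every d ∈ [1, cm], and with its negative every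
-- nonzero residue mod v, is a difference inside some E_s: every pair lies in a translate.
module Submission where

open import Defs
open import Data.Nat using (ℕ; _≤_; _+_; _*_; _∸_)

open import Level using (0ℓ)
open import Data.Nat
open import Data.Nat.Properties
open import Data.Nat.DivMod
open import Data.Nat.Combinatorics using (_C_; nC1≡n; nCk+nC[k+1]≡[n+1]C[k+1])
open import Data.Nat.Tactic.RingSolver using (solve-∀)
open import Data.Bool using (if_then_else_; true; false; _∧_)
open import Data.Fin using (Fin; toℕ; fromℕ<)
open import Data.Fin.Properties using (toℕ<n; toℕ-fromℕ<; toℕ-injective)
open import Data.Fin.Subset using (Subset; ∣_∣) renaming (_∩_ to _∩ₛ_; _∈_ to _∈ₛ_)
open import Data.Vec using (tabulate; _∷_)
open import Data.Vec.Properties using (lookup∘tabulate; lookup⇒[]=; tabulate-cong)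
open import Data.Product using (_×_; _,_; ∃-syntax; map₂; swap)
open import Data.Product.Function.NonDependent.Propositional using (_×-⇔_)
open import Data.Sum using (_⊎_; inj₁; inj₂)
open import Data.Empty using (⊥-elim)
open import Function using (_∘_; id; _⇔_; mk⇔)
open import Function.Properties.Equivalence using () renaming (refl to ⇔-refl; sym to ⇔-sym; trans to ⇔-trans)
open import Relation.Nullary using (yes; no; does; ¬_)
open import Relation.Nullary.Decidable using (does-⇔; _×-dec_; dec-true)
open import Relation.Unary using (Pred; Decidable; ｛_｝; _∪_; _∩_; _⊥_)
open import Relation.Unary.Properties using (_∪?_; _∩?_)
open import Relation.Binary using (tri<; tri≈; tri>)
open import Relation.Binary.PropositionalEquality

private variable
  P Q : Pred ℕ 0ℓ

count : Decidable P → ℕ → ℕ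
count P? zero    = zero
count P? (suc n) = (if does (P? 0) then suc else id) (count (P? ∘ suc) n)

count-cong : ∀ n (P? : Decidable P) (Q? : Decidable Q) →
             (∀ {y} → y < n → P y ⇔ Q y) → count P? n ≡ count Q? n
count-cong zero    P? Q? P⇔Q = refl
count-cong (suc n) P? Q? P⇔Q =
  cong₂ (λ b r → (if b then suc else id) r) (does-⇔ (P⇔Q z<s) (P? 0) (Q? 0))
        (count-cong n (P? ∘ suc) (Q? ∘ suc) (P⇔Q ∘ s<s))

count-+ : ∀ m n (P? : Decidable P) → count P? (m + n) ≡ count P? m + count (P? ∘ (m +_)) n
count-+ zero    n P? = refl
count-+ (suc m) n P? with does (P? 0)
... | true  = cong suc (count-+ m n (P? ∘ suc))
... | false = count-+ m n (P? ∘ suc)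

count-all : ∀ n (P? : Decidable P) → (∀ {y} → y < n → P y) → count P? n ≡ n
count-all zero    P? all = refl
count-all (suc n) P? all with P? 0
... | yes _  = cong suc (count-all n (P? ∘ suc) (all ∘ s<s))
... | no ¬p = ⊥-elim (¬p (all z<s))

count-none : ∀ n (P? : Decidable P) → (∀ {y} → y < n → ¬ P y) → count P? n ≡ 0
count-none zero    P? none = refl
count-none (suc n) P? none with P? 0
... | yes p = ⊥-elim (none z<s p)
... | no _  = count-none n (P? ∘ suc) (none ∘ s<s)

count-∪ : ∀ n (P? : Decidable P) (Q? : Decidable Q) → P ⊥ Q →
          count (P? ∪? Q?) n ≡ count P? n + count Q? n
count-∪ zero    P? Q? P⊥Q = refl
count-∪ (suc n) P? Q? P⊥Q with P? 0 | Q? 0 | count-∪ n (P? ∘ suc) (Q? ∘ suc) P⊥Q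
... | yes p | yes q | _  = ⊥-elim (P⊥Q (p , q))
... | yes _ | no _  | ih = cong suc ih
... | no _  | yes _ | ih = trans (cong suc ih) (sym (+-suc _ _))
... | no _  | no _  | ih = ih

count-∘-cong : ∀ n (P? : Decidable P) {f g : ℕ → ℕ} → (∀ {y} → y < n → f y ≡ g y) →
               count (P? ∘ f) n ≡ count (P? ∘ g) n
count-∘-cong {P = P} n P? f≡g =
  count-cong n (P? ∘ _) (P? ∘ _) (λ y<n → mk⇔ (subst P (f≡g y<n)) (subst P (sym (f≡g y<n))))

Interval : ℕ → ℕ → Pred ℕ 0ℓ
Interval a n z = a ≤ z × z < a + n

interval? : ∀ a n → Decidable (Interval a n)
interval? a n z = a ≤? z ×-dec z <? a + n

count-interval : ∀ a n {N} → a + n ≤ N → count (interval? a n) N ≡ n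
count-interval a n {N} a+n≤N = begin
  count (interval? a n) N                                  ≡⟨ cong (count (interval? a n)) N≡ ⟨
  count (interval? a n) (a + (n + r))                      ≡⟨ count-+ a (n + r) (interval? a n) ⟩
  count (interval? a n) a + count shifted (n + r)          ≡⟨ cong₂ _+_ below (count-+ n r shifted) ⟩
  count shifted n + count (shifted ∘ (n +_)) r             ≡⟨ cong₂ _+_ inside above ⟩
  n + 0                                                    ≡⟨ +-identityʳ n ⟩
  n                                                        ∎
  where
  open ≡-Reasoning
  r = N ∸ (a + n)
  N≡ : a + (n + r) ≡ N
  N≡ = trans (sym (+-assoc a n r)) (m+[n∸m]≡n a+n≤N)
  shifted = interval? a n ∘ (a +_)
  below  = count-none a (interval? a n) (λ y<a (a≤y , _) → <⇒≱ y<a a≤y)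
  inside = count-all n shifted (λ y<n → m≤m+n a _ , +-monoʳ-< a y<n)
  above  = count-none r (shifted ∘ (n +_))
             (λ {y} _ (_ , lt) → <⇒≱ lt (≤-trans (m≤m+n (a + n) y) (≤-reflexive (+-assoc a n y))))

count-singleton : ∀ p {N} → p < N → count (p ≟_) N ≡ 1
count-singleton p {N} p<N = trans
  (count-cong N (p ≟_) (interval? p 1)
    (λ {y} _ → mk⇔ (λ { refl → ≤-refl , m<m+n p z<s })
                   (λ (p≤y , y<p+1) → ≤-antisym p≤y (m<1+n⇒m≤n (subst (y <_) (+-comm p 1) y<p+1)))))
  (count-interval p 1 (subst (_≤ N) (+-comm 1 p) p<N))

[m%d+n]%d≡[m+n]%d : ∀ m n d .{{_ : NonZero d}} → (m % d + n) % d ≡ (m + n) % d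
[m%d+n]%d≡[m+n]%d m n d = begin
  (m % d + n) % d            ≡⟨ %-distribˡ-+ (m % d) n d ⟩
  (m % d % d + n % d) % d    ≡⟨ cong (λ x → (x + n % d) % d) (m%n%n≡m%n m d) ⟩
  (m % d + n % d) % d        ≡⟨ %-distribˡ-+ m n d ⟨
  (m + n) % d                ∎
  where open ≡-Reasoning

[m+n%d]%d≡[m+n]%d : ∀ m n d .{{_ : NonZero d}} → (m + n % d) % d ≡ (m + n) % d
[m+n%d]%d≡[m+n]%d m n d = begin
  (m + n % d) % d   ≡⟨ cong (_% d) (+-comm m (n % d)) ⟩
  (n % d + m) % d   ≡⟨ [m%d+n]%d≡[m+n]%d n m d ⟩
  (n + m) % d       ≡⟨ cong (_% d) (+-comm n m) ⟩
  (m + n) % d       ∎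
  where open ≡-Reasoning

count-rotate : ∀ v .{{_ : NonZero v}} t (P? : Decidable P) →
               count (P? ∘ λ y → (y + t) % v) v ≡ count P? v
count-rotate v t P? = begin
  count (P? ∘ λ y → (y + t) % v) v
    ≡⟨ count-∘-cong v P? (λ {y} _ → sym ([m+n%d]%d≡[m+n]%d y t v)) ⟩
  count (P? ∘ λ y → (y + r) % v) v
    ≡⟨ cong (count (P? ∘ λ y → (y + r) % v)) (m∸n+n≡m r≤v) ⟨
  count (P? ∘ λ y → (y + r) % v) ((v ∸ r) + r)
    ≡⟨ count-+ (v ∸ r) r _ ⟩
  count (P? ∘ λ y → (y + r) % v) (v ∸ r) + count (P? ∘ λ y → (v ∸ r + y + r) % v) r
    ≡⟨ cong₂ _+_ (count-∘-cong (v ∸ r) P? unwrapped) (count-∘-cong r P? wrapped) ⟩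
  count (P? ∘ (r +_)) (v ∸ r) + count P? r
    ≡⟨ +-comm _ (count P? r) ⟩
  count P? r + count (P? ∘ (r +_)) (v ∸ r)
    ≡⟨ count-+ r (v ∸ r) P? ⟨
  count P? (r + (v ∸ r))
    ≡⟨ cong (count P?) (m+[n∸m]≡n r≤v) ⟩
  count P? v
    ∎
  where
  open ≡-Reasoning
  r = t % v
  r≤v : r ≤ v
  r≤v = m%n≤n t v
  unwrapped : ∀ {y} → y < v ∸ r → (y + r) % v ≡ r + y
  unwrapped {y} y<v∸r = trans (m<n⇒m%n≡m (subst (y + r <_) (m∸n+n≡m r≤v) (+-monoˡ-< r y<v∸r)))
                              (+-comm y r)
  +-rotate : ∀ u y r → u + y + r ≡ y + (u + r)
  +-rotate = solve-∀
  wrapped : ∀ {y} → y < r → (v ∸ r + y + r) % v ≡ y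
  wrapped {y} y<r = begin
    (v ∸ r + y + r) % v     ≡⟨ cong (_% v) (+-rotate (v ∸ r) y r) ⟩
    (y + (v ∸ r + r)) % v   ≡⟨ cong (λ x → (y + x) % v) (m∸n+n≡m r≤v) ⟩
    (y + v) % v             ≡⟨ [m+n]%n≡m%n y v ⟩
    y % v                   ≡⟨ m<n⇒m%n≡m (<-≤-trans y<r r≤v) ⟩
    y                       ∎

subset : ∀ {n} → Decidable P → Subset n
subset P? = tabulate (does ∘ P? ∘ toℕ)

∣subset∣ : ∀ n (P? : Decidable P) → ∣ subset {n = n} P? ∣ ≡ count P? n
∣subset∣ zero    P? = refl
∣subset∣ (suc n) P? with P? 0
... | yes _ = cong suc (∣subset∣ n (P? ∘ suc))
... | no _  = ∣subset∣ n (P? ∘ suc)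

subset-∩ : ∀ n (P? : Decidable P) (Q? : Decidable Q) → subset {n = n} P? ∩ₛ subset Q? ≡ subset (P? ∩? Q?)
subset-∩ zero    P? Q? = refl
subset-∩ (suc n) P? Q? = cong (does (P? 0) ∧ does (Q? 0) ∷_) (subset-∩ n (P? ∘ suc) (Q? ∘ suc))

∈-subset : ∀ {n} (P? : Decidable P) {x : Fin n} → P (toℕ x) → x ∈ₛ subset P?
∈-subset P? {x} p = lookup⇒[]= x _ (trans (lookup∘tabulate _ x) (dec-true (P? (toℕ x)) p))

[m+kn]%n≡m : ∀ {m} k n .{{_ : NonZero n}} → m < n → (m + k * n) % n ≡ m
[m+kn]%n≡m {m} k n m<n = trans ([m+kn]%n≡m%n m k n) (m<n⇒m%n≡m m<n)

[m+kn]/n≡k : ∀ {m} k n .{{_ : NonZero n}} → m < n → (m + k * n) / n ≡ k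
[m+kn]/n≡k {m} k n m<n = begin
  (m + k * n) / n       ≡⟨ +-distrib-/ m (k * n) remainders<n ⟩
  m / n + k * n / n     ≡⟨ cong₂ _+_ (m<n⇒m/n≡0 m<n) (m*n/n≡m k n) ⟩
  k                     ∎
  where
  open ≡-Reasoning
  remainders<n : m % n + k * n % n < n
  remainders<n = subst (_< n) (sym (trans (cong₂ _+_ (m<n⇒m%n≡m m<n) (m*n%n≡0 k n)) (+-identityʳ m))) m<n

/-%-suc : ∀ n c .{{_ : NonZero c}} →
          (suc (n % c) < c × suc n / c ≡ n / c × suc n % c ≡ suc (n % c)) ⊎
          (suc (n % c) ≡ c × suc n / c ≡ suc (n / c) × suc n % c ≡ 0)
/-%-suc n c with m≤n⇒m<n∨m≡n (m%n<n n c)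
... | inj₁ lt = inj₁ (lt , trans (cong (_/ c) sucn) ([m+kn]/n≡k (n / c) c lt)
                         , trans (cong (_% c) sucn) ([m+kn]%n≡m (n / c) c lt))
  where sucn = cong suc (m≡m%n+[m/n]*n n c)
... | inj₂ eq = inj₂ (eq , trans (cong (_/ c) sucn) (m*n/n≡m (suc (n / c)) c)
                         , trans (cong (_% c) sucn) (m*n%n≡0 (suc (n / c)) c))
  where sucn = trans (cong suc (m≡m%n+[m/n]*n n c)) (cong (_+ n / c * c) eq)

module Development (v c : ℕ) .{{_ : NonZero v}} .{{_ : NonZero c}}
                   {E : ℕ → Pred ℕ 0ℓ} (E? : ∀ s → Decidable (E s)) where

  rot : ℕ → ℕ → ℕ
  rot t x = (x + t) % v

  -- Block t·c + s is the translate E_s − t.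
  block? : ∀ n → Decidable (E (n % c) ∘ rot (n / c))
  block? n = E? (n % c) ∘ rot (n / c)

  block : ℕ → Subset v
  block n = subset (block? n)

  ∣block∣ : ∀ {k} → (∀ s → s < c → count (E? s) v ≡ k) → ∀ n → ∣ block n ∣ ≡ k
  ∣block∣ {k} size n = begin
    ∣ block n ∣                ≡⟨ ∣subset∣ v (block? n) ⟩
    count (block? n) v         ≡⟨ count-rotate v (n / c) (E? (n % c)) ⟩
    count (E? (n % c)) v       ≡⟨ size (n % c) (m%n<n n c) ⟩
    k                          ∎
    where open ≡-Reasoning

  ∣block∩block∣ : ∀ m n → ∣ block m ∩ₛ block n ∣ ≡ count (block? m ∩? block? n) v
  ∣block∩block∣ m n = trans (cong ∣_∣ (subset-∩ v (block? m) (block? n))) (∣subset∣ v _)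

  rot-suc : ∀ t x → rot (suc t) x ≡ rot 1 (rot t x)
  rot-suc t x = sym (trans ([m%d+n]%d≡[m+n]%d (x + t) 1 v)
                           (cong (_% v) (trans (+-comm (x + t) 1) (sym (+-suc x t)))))

  ∣block∩block-suc∣ : ∀ {k} →
    (∀ s → suc s < c → count (E? s ∩? E? (suc s)) v ≡ k) →
    count (E? (c ∸ 1) ∩? E? 0 ∘ rot 1) v ≡ k →
    ∀ n → ∣ block n ∩ₛ block (suc n) ∣ ≡ k
  ∣block∩block-suc∣ {k} within across n with /-%-suc n c
  ... | inj₁ (s+1<c , q≡ , r≡) = begin
    ∣ block n ∩ₛ block (suc n) ∣
      ≡⟨ ∣block∩block∣ n (suc n) ⟩
    count (block? n ∩? block? (suc n)) v
      ≡⟨ cong₂ (λ s′ t′ → count (E? s ∘ rot t ∩? E? s′ ∘ rot t′) v) r≡ q≡ ⟩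
    count ((E? s ∩? E? (suc s)) ∘ rot t) v
      ≡⟨ count-rotate v t _ ⟩
    count (E? s ∩? E? (suc s)) v
      ≡⟨ within s s+1<c ⟩
    k ∎
    where
    open ≡-Reasoning
    s = n % c
    t = n / c
  ... | inj₂ (s+1≡c , q≡ , r≡) = begin
    ∣ block n ∩ₛ block (suc n) ∣
      ≡⟨ ∣block∩block∣ n (suc n) ⟩
    count (block? n ∩? block? (suc n)) v
      ≡⟨ cong₂ (λ s′ t′ → count (E? s ∘ rot t ∩? E? s′ ∘ rot t′) v) r≡ q≡ ⟩
    count (E? s ∘ rot t ∩? E? 0 ∘ rot (suc t)) v
      ≡⟨ count-cong v _ _ (λ {x} _ → mk⇔ (map₂ (subst (E 0) (rot-suc t x)))
                                          (map₂ (subst (E 0) (sym (rot-suc t x))))) ⟩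
    count ((E? s ∩? E? 0 ∘ rot 1) ∘ rot t) v
      ≡⟨ count-rotate v t _ ⟩
    count (E? s ∩? E? 0 ∘ rot 1) v
      ≡⟨ cong (λ s′ → count (E? s′ ∩? E? 0 ∘ rot 1) v) (cong (_∸ 1) s+1≡c) ⟩
    count (E? (c ∸ 1) ∩? E? 0 ∘ rot 1) v
      ≡⟨ across ⟩
    k ∎
    where
    open ≡-Reasoning
    s = n % c
    t = n / c

  block-periodic : block (v * c) ≡ block 0
  block-periodic = tabulate-cong λ x →
    cong₂ (λ s y → does (E? s y)) (trans (m*n%n≡0 v c) (sym (m*n%n≡0 0 c))) (rot-period (toℕ x))
    where
    rot-period : ∀ x → rot (v * c / c) x ≡ rot (0 / c) x
    rot-period x = begin
      (x + v * c / c) % v  ≡⟨ cong (λ q → (x + q) % v) (m*n/n≡m v c) ⟩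
      (x + v) % v          ≡⟨ [m+n]%n≡m%n x v ⟩
      x % v                ≡⟨ cong (_% v) (+-identityʳ x) ⟨
      (x + 0) % v          ≡⟨ cong (λ q → (x + q) % v) (0/n≡0 c) ⟨
      (x + 0 / c) % v      ∎
      where open ≡-Reasoning

  Realised : ℕ → Set
  Realised d = ∃[ s ] ∃[ z ] (s < c × z < v × E s z × E s ((z + d) % v))

  realised-complement : ∀ {d} → d ≤ v → Realised d → Realised (v ∸ d)
  realised-complement {d} d≤v (s , z , s<c , z<v , Ez , Ez+d) =
    s , (z + d) % v , s<c , m%n<n (z + d) v , Ez+d , subst (E s) (sym wraps) Ez
    where
    open ≡-Reasoning
    wraps : ((z + d) % v + (v ∸ d)) % v ≡ z
    wraps = begin
      ((z + d) % v + (v ∸ d)) % v  ≡⟨ [m%d+n]%d≡[m+n]%d (z + d) (v ∸ d) v ⟩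
      (z + d + (v ∸ d)) % v        ≡⟨ cong (_% v) (trans (+-assoc z d (v ∸ d)) (cong (z +_) (m+[n∸m]≡n d≤v))) ⟩
      (z + v) % v                  ≡⟨ [m+n]%n≡m%n z v ⟩
      z % v                        ≡⟨ m<n⇒m%n≡m z<v ⟩
      z                            ∎

  ∈-block : ∀ {s} t (x : Fin v) → s < c → E s ((toℕ x + t) % v) → x ∈ₛ block (s + t % v * c)
  ∈-block {s} t x s<c Ex = ∈-subset (block? n) (subst₂ E (sym ([m+kn]%n≡m (t % v) c s<c)) (sym rot-n) Ex)
    where
    n = s + t % v * c
    rot-n : rot (n / c) (toℕ x) ≡ (toℕ x + t) % v
    rot-n = trans (cong (λ q → (toℕ x + q) % v) ([m+kn]/n≡k (t % v) c s<c)) ([m+n%d]%d≡[m+n]%d (toℕ x) t v)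

  index< : ∀ {s} t → s < c → s + t % v * c < v * c
  index< {s} t s<c = ≤-trans (+-monoˡ-< (t % v * c) s<c) (*-monoˡ-≤ c (m%n<n t v))

  translate-lands : ∀ {a b} z → a ≤ v → a ≤ b → (b + ((v ∸ a) + z)) % v ≡ (z + (b ∸ a)) % v
  translate-lands {a} {b} z a≤v a≤b = begin
    (b + ((v ∸ a) + z)) % v              ≡⟨ cong (λ b′ → (b′ + ((v ∸ a) + z)) % v) (m+[n∸m]≡n a≤b) ⟨
    (a + (b ∸ a) + ((v ∸ a) + z)) % v    ≡⟨ cong (_% v) (rearrange a (b ∸ a) (v ∸ a) z) ⟩
    (z + (b ∸ a) + (a + (v ∸ a))) % v    ≡⟨ cong (λ w → (z + (b ∸ a) + w) % v) (m+[n∸m]≡n a≤v) ⟩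
    (z + (b ∸ a) + v) % v                ≡⟨ [m+n]%n≡m%n (z + (b ∸ a)) v ⟩
    (z + (b ∸ a)) % v                    ∎
    where
    open ≡-Reasoning
    rearrange : ∀ a e u z → a + e + (u + z) ≡ z + e + (a + u)
    rearrange = solve-∀

  covers-< : (∀ d → 0 < d → d < v → Realised d) → ∀ (x y : Fin v) → toℕ x < toℕ y →
             ∃[ i ] (x ∈ₛ block (toℕ {v * c} i) × y ∈ₛ block (toℕ i))
  covers-< realised x y x<y with realised (toℕ y ∸ toℕ x) (m<n⇒0<n∸m x<y) d<v
    where d<v = ≤-<-trans (m∸n≤m (toℕ y) (toℕ x)) (toℕ<n y)
  ... | s , z , s<c , z<v , Ez , Ez+d =
    i , member x (subst (E s) (sym x-lands) Ez) , member y (subst (E s) (sym y-lands) Ez+d)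
    where
    open ≡-Reasoning
    a≤v = <⇒≤ (toℕ<n x)
    t = (v ∸ toℕ x) + z
    i = fromℕ< (index< t s<c)
    member : ∀ w → E s ((toℕ w + t) % v) → w ∈ₛ block (toℕ i)
    member w Ew = subst (λ n → w ∈ₛ block n) (sym (toℕ-fromℕ< (index< t s<c))) (∈-block t w s<c Ew)
    x-lands : (toℕ x + t) % v ≡ z
    x-lands = begin
      (toℕ x + t) % v            ≡⟨ translate-lands z a≤v ≤-refl ⟩
      (z + (toℕ x ∸ toℕ x)) % v  ≡⟨ cong (λ e → (z + e) % v) (n∸n≡0 (toℕ x)) ⟩
      (z + 0) % v                ≡⟨ cong (_% v) (+-identityʳ z) ⟩
      z % v                      ≡⟨ m<n⇒m%n≡m z<v ⟩
      z                          ∎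
    y-lands : (toℕ y + t) % v ≡ (z + (toℕ y ∸ toℕ x)) % v
    y-lands = translate-lands z a≤v (<⇒≤ x<y)

  record CyclicBase (k : ℕ) : Set where
    field
      size     : ∀ s → s < c → count (E? s) v ≡ k
      within   : ∀ s → suc s < c → count (E? s ∩? E? (suc s)) v ≡ k ∸ 1
      -- the last block of a round against the first block of the next one, E_0 − 1
      across   : count (E? (c ∸ 1) ∩? E? 0 ∘ rot 1) v ≡ k ∸ 1
      realised : ∀ d → 0 < d → d < v → Realised d

  development-SCCD : ∀ {k} → CyclicBase k → SCCD v k (v * c)
  development-SCCD base = record
    { block         = block ∘ toℕ
    ; block-size    = ∣block∣ size ∘ toℕ
    ; single-change = single-change
    ; covering      = covering
    }
    where
    open CyclicBase base
    single-change : ∀ i j → CyclicSucc i j → ∣ block (toℕ i) ∩ₛ block (toℕ j) ∣ ≡ _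
    single-change i j (inj₁ next) =
      subst (λ n → ∣ block (toℕ i) ∩ₛ block n ∣ ≡ _) next (∣block∩block-suc∣ within across (toℕ i))
    single-change i j (inj₂ (last , first)) =
      subst (λ B → ∣ block (toℕ i) ∩ₛ B ∣ ≡ _) wraps (∣block∩block-suc∣ within across (toℕ i))
      where
      wraps : block (suc (toℕ i)) ≡ block (toℕ j)
      wraps = trans (cong block last) (trans block-periodic (cong block (sym first)))
    covering : ∀ (x y : Fin v) → x ≢ y → ∃[ i ] (x ∈ₛ block (toℕ i) × y ∈ₛ block (toℕ i))
    covering x y x≢y with <-cmp (toℕ x) (toℕ y)
    ... | tri< x<y _ _ = covers-< realised x y x<y
    ... | tri≈ _ x≡y _ = ⊥-elim (x≢y (toℕ-injective x≡y))
    ... | tri> _ _ y<x = map₂ swap (covers-< realised y x y<x)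

∪-∩-∪⇔ : {P Q R : Pred ℕ 0ℓ} → Q ⊥ R → ∀ {x} → ((P ∪ Q) ∩ (P ∪ R)) x ⇔ P x
∪-∩-∪⇔ {P} {Q} {R} Q⊥R {x} = mk⇔ to (λ p → inj₁ p , inj₁ p)
  where
  to : ((P ∪ Q) ∩ (P ∪ R)) x → P x
  to (inj₁ p , _)        = p
  to (inj₂ _ , inj₁ p)   = p
  to (inj₂ q , inj₂ r)   = ⊥-elim (Q⊥R (q , r))

singletons-⊥ : ∀ {p q : ℕ} → p ≢ q → ｛ p ｝ ⊥ ｛ q ｝
singletons-⊥ p≢q (refl , q≡p) = p≢q (sym q≡p)

module BaseBlocks (c m : ℕ) .{{_ : NonZero c}} .{{_ : NonZero m}} where

  h v : ℕ
  h = c * m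
  v = suc (h + h)

  Core : Pred ℕ 0ℓ
  Core = Interval 1 m

  core∪? : ∀ p → Decidable (Core ∪ ｛ p ｝)
  core∪? p = interval? 1 m ∪? (p ≟_)

  apex : ℕ → ℕ
  apex s = suc (suc s * m)

  Base : ℕ → Pred ℕ 0ℓ
  Base s = Core ∪ ｛ apex s ｝

  base? : ∀ s → Decidable (Base s)
  base? s = core∪? (apex s)

  open Development v c base?

  m≤h : m ≤ h
  m≤h = subst (_≤ h) (*-identityˡ m) (*-monoˡ-≤ m (>-nonZero⁻¹ c))

  h<v : h < v
  h<v = s≤s (m≤m+n h h)

  core<apex : ∀ {z} s → Core z → z < apex s
  core<apex s (_ , z<1+m) = ≤-trans z<1+m (s≤s (m≤m+n m (s * m)))

  apex<v : ∀ {s} → s < c → apex s < v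
  apex<v s<c = s≤s (≤-<-trans (*-monoˡ-≤ m s<c) (m<m+n h (<-≤-trans (>-nonZero⁻¹ m) m≤h)))

  apex<apex-suc : ∀ s → apex s < apex (suc s)
  apex<apex-suc s = s≤s (m<n+m (suc s * m) (>-nonZero⁻¹ m))

  count-core : count (interval? 1 m) v ≡ m
  count-core = count-interval 1 m (≤-<-trans m≤h h<v)

  count-base : ∀ s → s < c → count (base? s) v ≡ suc m
  count-base s s<c = begin
    count (base? s) v                              ≡⟨ count-∪ v (interval? 1 m) (apex s ≟_) core⊥apex ⟩
    count (interval? 1 m) v + count (apex s ≟_) v  ≡⟨ cong₂ _+_ count-core (count-singleton (apex s) (apex<v s<c)) ⟩
    m + 1                                          ≡⟨ +-comm m 1 ⟩
    suc m                                          ∎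
    where
    open ≡-Reasoning
    core⊥apex : Core ⊥ ｛ apex s ｝
    core⊥apex (core , refl) = <-irrefl refl (core<apex s core)

  count-shared : ∀ p q → p ≢ q → count (core∪? p ∩? core∪? q) v ≡ m
  count-shared p q p≢q = trans (count-cong v (core∪? p ∩? core∪? q) (interval? 1 m) shared) count-core
    where
    shared : ∀ {y} → y < v → ((Core ∪ ｛ p ｝) ∩ (Core ∪ ｛ q ｝)) y ⇔ Core y
    shared _ = ∪-∩-∪⇔ {P = Core} {Q = ｛ p ｝} {R = ｛ q ｝} (singletons-⊥ p≢q)

  base₀∘suc⇔≤m : ∀ z → Base 0 (suc z) ⇔ z ≤ m
  base₀∘suc⇔≤m z = mk⇔ to from
    where
    to : Base 0 (suc z) → z ≤ m
    to (inj₁ (_ , s≤s z<m)) = <⇒≤ z<m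
    to (inj₂ m+0≡z)        = ≤-reflexive (trans (sym (suc-injective m+0≡z)) (+-identityʳ m))
    from : z ≤ m → Base 0 (suc z)
    from z≤m with m≤n⇒m<n∨m≡n z≤m
    ... | inj₁ z<m  = inj₁ (s≤s z≤n , s≤s z<m)
    ... | inj₂ refl = inj₂ (cong suc (+-identityʳ m))

  core∪0⇔≤m : ∀ z → (Core ∪ ｛ 0 ｝) z ⇔ z ≤ m
  core∪0⇔≤m z = mk⇔ to from
    where
    to : ∀ {z} → (Core ∪ ｛ 0 ｝) z → z ≤ m
    to (inj₁ (_ , s≤s z≤m)) = z≤m
    to (inj₂ refl)          = z≤n
    from : ∀ {z} → z ≤ m → (Core ∪ ｛ 0 ｝) z
    from {zero}  _    = inj₂ refl
    from {suc z} z<m = inj₁ (s≤s z≤n , s≤s z<m)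

  -- E_0 = {1,…,m+1}, so E_0 − 1 = {0,…,m}; the wrap-around point v − 1 is not in it.
  base₀∘next⇔≤m : ∀ {z} → z < v → Base 0 ((z + 1) % v) ⇔ z ≤ m
  base₀∘next⇔≤m {z} z<v with m<1+n⇒m<n∨m≡n z<v
  ... | inj₁ z<h+h = subst (λ y → Base 0 y ⇔ z ≤ m) (sym no-wrap) (base₀∘suc⇔≤m z)
    where
    no-wrap : (z + 1) % v ≡ suc z
    no-wrap = trans (cong (_% v) (+-comm z 1)) (m<n⇒m%n≡m (s≤s z<h+h))
  ... | inj₂ refl = subst (λ y → Base 0 y ⇔ h + h ≤ m) (sym wraps)
                          (mk⇔ (λ { (inj₁ (() , _)) ; (inj₂ ()) }) (λ h+h≤m → ⊥-elim (<⇒≱ m<h+h h+h≤m)))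
    where
    wraps : (h + h + 1) % v ≡ 0
    wraps = trans (cong (_% v) (+-comm (h + h) 1)) (n%n≡0 v)
    m<h+h : m < h + h
    m<h+h = ≤-<-trans m≤h (m<m+n h (<-≤-trans (>-nonZero⁻¹ m) m≤h))

  -- d = 1 + j + q·m with j < m is the difference between the core point m − j and apex q.
  realised-small : ∀ d → 0 < d → d ≤ h → Realised d
  realised-small (suc d′) _ d≤h =
    q , m ∸ j , q<c , m∸j<v , inj₁ (m<n⇒0<n∸m j<m , s≤s (m∸n≤m m j)) , inj₂ (sym lands)
    where
    open ≡-Reasoning
    q = d′ / m
    j = d′ % m
    j<m : j < m
    j<m = m%n<n d′ m
    m∸j<v : m ∸ j < v
    m∸j<v = ≤-<-trans (m∸n≤m m j) (≤-<-trans m≤h h<v)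
    q<c : q < c
    q<c = m<n*o⇒m/o<n d≤h
    sum : m ∸ j + suc d′ ≡ apex q
    sum = begin
      m ∸ j + suc d′            ≡⟨ +-suc (m ∸ j) d′ ⟩
      suc (m ∸ j + d′)          ≡⟨ cong (λ x → suc (m ∸ j + x)) (m≡m%n+[m/n]*n d′ m) ⟩
      suc (m ∸ j + (j + q * m)) ≡⟨ cong suc (+-assoc (m ∸ j) j (q * m)) ⟨
      suc (m ∸ j + j + q * m)   ≡⟨ cong (λ x → suc (x + q * m)) (m∸n+n≡m (<⇒≤ j<m)) ⟩
      suc (m + q * m)           ∎
    lands : (m ∸ j + suc d′) % v ≡ apex q
    lands = trans (cong (_% v) sum) (m<n⇒m%n≡m (apex<v q<c))

  realised : ∀ d → 0 < d → d < v → Realised d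
  realised d 0<d d<v with d ≤? h
  ... | yes d≤h = realised-small d 0<d d≤h
  ... | no d≰h  = subst Realised (m∸[m∸n]≡n (<⇒≤ d<v))
                    (realised-complement (m∸n≤m v d) (realised-small (v ∸ d) (m<n⇒0<n∸m d<v) v∸d≤h))
    where
    v∸d≤h : v ∸ d ≤ h
    v∸d≤h = ≤-trans (∸-monoʳ-≤ v (≰⇒> d≰h)) (≤-reflexive (m+n∸n≡m h h))

  cyclicBase : CyclicBase (suc m)
  cyclicBase = record
    { size     = count-base
    ; within   = λ s _ → count-shared (apex s) (apex (suc s)) (<⇒≢ (apex<apex-suc s))
    ; across   = trans (count-cong v (base? (c ∸ 1) ∩? base? 0 ∘ rot 1) (base? (c ∸ 1) ∩? core∪? 0)
                                   (λ {z} z<v → ⇔-refl ×-⇔ ⇔-trans (base₀∘next⇔≤m z<v) (⇔-sym (core∪0⇔≤m z))))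
                       (count-shared (apex (c ∸ 1)) 0 λ ())
    ; realised = realised
    }

  sccd : SCCD v (suc m) (v * c)
  sccd = development-SCCD cyclicBase

[1+n]C2*2≡[1+n]*n : ∀ n → (suc n C 2) * 2 ≡ suc n * n
[1+n]C2*2≡[1+n]*n zero    = refl
[1+n]C2*2≡[1+n]*n (suc n) = begin
  (suc (suc n) C 2) * 2          ≡⟨ cong (_* 2) (nCk+nC[k+1]≡[n+1]C[k+1] (suc n) 1) ⟨
  (suc n C 1 + suc n C 2) * 2    ≡⟨ cong (λ x → (x + suc n C 2) * 2) (nC1≡n (suc n)) ⟩
  (suc n + suc n C 2) * 2        ≡⟨ *-distribʳ-+ 2 (suc n) (suc n C 2) ⟩
  suc n * 2 + (suc n C 2) * 2    ≡⟨ cong (suc n * 2 +_) ([1+n]C2*2≡[1+n]*n n) ⟩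
  suc n * 2 + suc n * n          ≡⟨ *-distribˡ-+ (suc n) 2 n ⟨
  suc n * suc (suc n)            ≡⟨ *-comm (suc n) (suc (suc n)) ⟩
  suc (suc n) * suc n            ∎
  where open ≡-Reasoning

tightness : ∀ c m → (c * c * (2 * m) + c) * m ≡ suc (2 * c * m) C 2
tightness c m = *-cancelʳ-≡ _ _ 2 (begin
  (c * c * (2 * m) + c) * m * 2  ≡⟨ expand c m ⟩
  suc (2 * c * m) * (2 * c * m)  ≡⟨ [1+n]C2*2≡[1+n]*n (2 * c * m) ⟨
  (suc (2 * c * m) C 2) * 2      ∎)
  where
  open ≡-Reasoning
  expand : ∀ c m → (c * c * (2 * m) + c) * m * 2 ≡ suc (2 * c * m) * (2 * c * m)
  expand = solve-∀

theorem7 : ∀ (k c : ℕ) → 2 ≤ k → 1 ≤ c →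
    TightSCCD (2 * c * (k ∸ 1) + 1) k (c * c * (2 * k ∸ 2) + c)
theorem7 k@(suc m@(suc _)) c@(suc _) (s≤s (s≤s z≤n)) (s≤s z≤n) = record
  { design = subst₂ (λ v b → SCCD v k b) (v≡ c m) (trans (b≡ c m) blocks) sccd
  ; tight  = subst₂ (λ b v → b * m ≡ v C 2) blocks (+-comm 1 (2 * c * m)) (tightness c m)
  }
  where
  open BaseBlocks c m
  v≡ : ∀ c m → suc (c * m + c * m) ≡ 2 * c * m + 1
  v≡ = solve-∀
  b≡ : ∀ c m → suc (c * m + c * m) * c ≡ c * c * (2 * m) + c
  b≡ = solve-∀
  blocks : c * c * (2 * m) + c ≡ c * c * (2 * k ∸ 2) + c
  blocks = cong (λ x → c * c * x + c) (cong (_∸ 2) (sym (*-suc 2 m)))
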